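{- Work in the semantics described in the context. Consider the axioms (A1') $\boldsymbol{\neg}\,\mathcal{P}(\lambda x.\, x \boldsymbol{\neq} x)$; (A2'') $\boldsymbol{\forall} X\, Y.\ \big((\mathcal{P}\,X \boldsymbol{\wedge} X \boldsymbol{\sqsubseteq} Y) \boldsymbol{\rightarrow} \mathcal{P}\,Y\big)$; (T2) $\mathcal{P}\,\mathcal{G}$. Then: (i) In modal logic $\mathbf{K}$ (arbitrary accessibility relation), in every model in which A1', A2'' and T2 are globally valid, both $\boldsymbol{\exists}^E \mathcal{G}$ and $\boldsymbol{\Box}(\boldsymbol{\exists}^E \mathcal{G})$ are globally valid. (ii) In modal logic $\mathbf{K}$, $\boldsymbol{\Diamond}(\boldsymbol{\exists}^E \mathcal{G})$ is not entailed: there is a model in which A1', A2'' and T2 are globally valid but $\boldsymbol{\Diamond}(\boldsymbol{\exists}^E \mathcal{G})$ is not globally valid. (iii) In modal logic $\mathbf{T}$, i.e. restricting to models whose accessibility relation is reflexive, in every model in which A1', A2'' and T2 are globally valid, $\boldsymbol{\Diamond}(\boldsymbol{\exists}^E \mathcal{G})$ is globally valid.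
   Context: Semantics (higher-order modal logic, possible-world semantics). A model consists of: a nonempty set $W$ of worlds; a binary accessibility relation $r$ on $W$; a nonempty set $D$ of individuals; a relation $\mathrm{existsAt} \subseteq D\times W$ (which may be empty at some worlds); and an interpretation of a constant $\mathcal{P}$. A proposition is a function $W\to\{\mathrm{true},\mathrm{false}\}$. A property is any function $D\to(W\to\{\mathrm{true},\mathrm{false}\})$, and $\mathcal{P}$ maps properties to propositions. Connectives are world-lifted and evaluated pointwise. $(\boldsymbol\Box\varphi)(w)$ iff $\varphi(v)$ for all $v$ with $r(w,v)$; $(\boldsymbol\Diamond\varphi)(w)$ iff $\varphi(v)$ for some $v$ with $r(w,v)$. Possibilist quantifiers $\boldsymbol\forall,\boldsymbol\exists$ range over all objects of the relevant type (individuals or properties). Actualist quantifiers over individuals: $(\boldsymbol\forall^E x.\,\Phi x)(w)$ iff $\Phi(a)(w)$ for all $a\in D$ with $\mathrm{existsAt}(a,w)$, and $\boldsymbol\exists^E$ is defined dually. $\boldsymbol\exists^E Y$ abbreviates $\boldsymbol\exists^E x.\,Y x$. Equality of individuals is world-independent identity, and $\boldsymbol\neq$ is its negation. A formula is globally valid iff it holds at every world. Definitions: $X \boldsymbol{\sqsubseteq} Y \equiv \boldsymbol\forall^E z.\,(X z \boldsymbol\rightarrow Y z)$; Godlike: $\mathcal{G}\,x \equiv \boldsymbol\forall Y.\,(\mathcal{P}\,Y \boldsymbol\rightarrow Y x)$. -}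

module Defs where

open import Data.Bool using (Bool; true; false; T; not; _∧_; _∨_)
open import Data.Product using (Σ; _×_; _,_)
open import Relation.Nullary using (Dec; does; ¬_)
open import Relation.Binary.PropositionalEquality using (_≡_)

-- The metatheory of the paper is classical.  Propositions are Bool-valued
-- (functions W → {true,false}); to define the truth value of quantified
-- formulas we use excluded middle, given as a hypothesis of the theorem.
LEM : Set₁
LEM = (A : Set) → Dec A

record Model : Set₁ where
  field
    W        : Set
    w₀       : W
    r        : W → W → Set
    D        : Set
    d₀       : D
    existsAt : D → W → Set             -- may be empty at some worlds
    𝒫        : (D → W → Bool) → (W → Bool)

module Sem (lem : LEM) (M : Model) where
  open Model M public

  Prop : Set
  Prop = W → Bool

  Property : Set
  Property = D → W → Bool

  ⌜_⌝ : Set → Bool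
  ⌜ A ⌝ = does (lem A)

  ¬ᵐ_ : Prop → Prop
  (¬ᵐ φ) w = not (φ w)

  _∧ᵐ_ : Prop → Prop → Prop
  (φ ∧ᵐ ψ) w = φ w ∧ ψ w

  _→ᵐ_ : Prop → Prop → Prop
  (φ →ᵐ ψ) w = not (φ w) ∨ ψ w

  □ : Prop → Prop
  □ φ w = ⌜ ((v : W) → r w v → T (φ v)) ⌝

  ◇ : Prop → Prop
  ◇ φ w = ⌜ Σ W (λ v → r w v × T (φ v)) ⌝

  ∀ᴾ : (Property → Prop) → Prop
  ∀ᴾ Φ w = ⌜ ((Y : Property) → T (Φ Y w)) ⌝

  ∀ᴱ : (D → Prop) → Prop
  ∀ᴱ Φ w = ⌜ ((a : D) → existsAt a w → T (Φ a w)) ⌝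

  ∃ᴱ : (D → Prop) → Prop
  ∃ᴱ Φ w = ⌜ Σ D (λ a → existsAt a w × T (Φ a w)) ⌝

  _≠ᵐ_ : D → D → Prop
  (x ≠ᵐ y) w = ⌜ ¬ (x ≡ y) ⌝

  _⊑_ : Property → Property → Prop
  X ⊑ Y = ∀ᴱ (λ z → X z →ᵐ Y z)

  𝒢 : Property
  𝒢 x = ∀ᴾ (λ Y → 𝒫 Y →ᵐ Y x)

  valid : Prop → Set
  valid φ = (w : W) → T (φ w)

  A1' : Prop
  A1' = ¬ᵐ 𝒫 (λ x → x ≠ᵐ x)

  A2'' : Prop
  A2'' = ∀ᴾ (λ X → ∀ᴾ (λ Y → (𝒫 X ∧ᵐ (X ⊑ Y)) →ᵐ 𝒫 Y))

  T2 : Prop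
  T2 = 𝒫 𝒢

  ∃ᴱ𝒢 : Prop
  ∃ᴱ𝒢 = ∃ᴱ (λ x → 𝒢 x)

module Submission where

-- The heart of the matter is that, under A1' and A2'', every
-- positive property is exemplified by an individual existing at the world
-- in question: if no existent had X, then X ⊑ Y would hold vacuously for
-- every Y, in particular for the self-difference property λ x. x ≠ x, and
-- A2'' would make that property positive, contradicting A1'.  Applying
-- this to 𝒢, which is positive by T2, shows that ∃ᴱ 𝒢 is globally valid.
-- Part (i) then follows by necessitation (a globally valid formula is
-- necessary in every frame), and part (iii) by the principle φ → ◇ φ of
-- reflexive frames.  For (ii) we take a single world that sees nothing
-- and a single individual •, and let 𝒫 Y hold exactly when • has Y: the
-- three axioms hold there, while ◇ ∃ᴱ 𝒢 fails as no world is accessible.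

open import Defs
open import Data.Bool using (Bool; true; false; T; not; _∨_)
open import Data.Bool.Properties using (T-∧)
open import Data.Empty using (⊥; ⊥-elim)
open import Data.Product using (Σ; _×_; _,_)
open import Data.Unit using (⊤; tt)
open import Function.Bundles using (Equivalence)
open import Relation.Nullary using (¬_; does; yes; no)
open import Relation.Binary.Definitions using (Reflexive)
open import Relation.Binary.PropositionalEquality using (refl)

module Oracle (lem : LEM) where

  oracle-intro : {A : Set} → A → T (does (lem A))
  oracle-intro {A} a with lem A
  ... | yes _ = tt
  ... | no ¬a = ¬a a

  oracle-elim : {A : Set} → T (does (lem A)) → A
  oracle-elim {A} t with lem A
  ... | yes a = a
  ... | no _  = ⊥-elim t

  oracle-refute : {A : Set} → ¬ A → T (not (does (lem A)))
  oracle-refute {A} ¬a with lem A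
  ... | yes a = ¬a a
  ... | no _  = tt

⇒-intro : (a b : Bool) → (T a → T b) → T (not a ∨ b)
⇒-intro true  b f = f tt
⇒-intro false b f = tt

⇒-elim : (a b : Bool) → T (not a ∨ b) → T a → T b
⇒-elim true b h _ = h

not-refutes : (a : Bool) → T (not a) → ¬ T a
not-refutes true  () _
not-refutes false _ ()

module _ (lem : LEM) (M : Model) where
  open Sem lem M
  open Oracle lem

  SelfDifferent : Property
  SelfDifferent x = x ≠ᵐ x

  vacuous-subsumption : (X Y : Property) (w : W) →
    ¬ Σ D (λ a → existsAt a w × T (X a w)) → T ((X ⊑ Y) w)
  vacuous-subsumption X Y w none = oracle-intro λ a a-exists →
    ⇒-intro (X a w) (Y a w) λ Xa → ⊥-elim (none (a , a-exists , Xa))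

  -- Under A1' and A2'' at w, a property positive at w is exemplified by an
  -- individual existing at w: otherwise X ⊑ SelfDifferent holds vacuously,
  -- so A2'' makes SelfDifferent positive, against A1'.
  positive-exemplified : (X : Property) (w : W) →
    T (A1' w) → T (A2'' w) → T (𝒫 X w) → T (∃ᴱ X w)
  positive-exemplified X w a1 a2 PX with lem (Σ D (λ a → existsAt a w × T (X a w)))
  ... | yes _   = tt
  ... | no none = not-refutes (𝒫 SelfDifferent w) a1 P-SelfDifferent
    where
    P-SelfDifferent : T (𝒫 SelfDifferent w)
    P-SelfDifferent =
      ⇒-elim ((𝒫 X ∧ᵐ (X ⊑ SelfDifferent)) w) (𝒫 SelfDifferent w)
        (oracle-elim (oracle-elim a2 X) SelfDifferent)
        (Equivalence.from T-∧ (PX , vacuous-subsumption X SelfDifferent w none))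

  godlike-exists : valid A1' → valid A2'' → valid T2 → valid ∃ᴱ𝒢
  godlike-exists a1 a2 t2 w = positive-exemplified 𝒢 w (a1 w) (a2 w) (t2 w)

  necessitation : (φ : Prop) → valid φ → valid (□ φ)
  necessitation φ φ-valid w = oracle-intro λ v _ → φ-valid v

  valid⇒possible : Reflexive r → (φ : Prop) → valid φ → valid (◇ φ)
  valid⇒possible reflexive φ φ-valid w = oracle-intro (w , reflexive , φ-valid w)

  blind⇒impossible : (w : W) → ((v : W) → ¬ r w v) → (φ : Prop) → ¬ T (◇ φ w)
  blind⇒impossible w blind φ possible with oracle-elim possible
  ... | v , w-sees-v , _ = blind v w-sees-v

-- The countermodel for (ii): one world seeing nothing, one individual •
-- existing there, and 𝒫 Y true exactly when • has Y (the positive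
-- properties form the principal ultrafilter at •).
BlindPoint : Model
BlindPoint = record
  { W = ⊤ ; w₀ = tt ; r = λ _ _ → ⊥
  ; D = ⊤ ; d₀ = tt ; existsAt = λ _ _ → ⊤
  ; 𝒫 = λ Y → Y tt
  }

module _ (lem : LEM) where
  open Sem lem BlindPoint
  open Oracle lem

  BlindPoint-A1' : valid A1'
  BlindPoint-A1' w = oracle-refute λ •≢• → •≢• refl

  -- If • has X and X ⊑ Y, then • has Y, since • exists.
  BlindPoint-A2'' : valid A2''
  BlindPoint-A2'' w = oracle-intro λ X → oracle-intro λ Y →
    ⇒-intro ((𝒫 X ∧ᵐ (X ⊑ Y)) w) (Y tt w) λ premises →
      let (•-has-X , X⊑Y) = Equivalence.to T-∧ premises
      in  ⇒-elim (X tt w) (Y tt w) (oracle-elim X⊑Y tt tt) •-has-X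

  -- • is godlike: it has every property that • has.
  BlindPoint-T2 : valid T2
  BlindPoint-T2 w = oracle-intro λ Y → ⇒-intro (Y tt w) (Y tt w) λ •-has-Y → •-has-Y

  BlindPoint-not-◇∃ᴱ𝒢 : ¬ valid (◇ ∃ᴱ𝒢)
  BlindPoint-not-◇∃ᴱ𝒢 ◇-valid =
    blind⇒impossible lem BlindPoint tt (λ _ ()) ∃ᴱ𝒢 (◇-valid tt)

mainTheorem4 : (lem : LEM) →
    ((M : Model) → let open Sem lem M in
       valid A1' → valid A2'' → valid T2 → valid ∃ᴱ𝒢 × valid (□ ∃ᴱ𝒢))
    × Σ Model (λ M → let open Sem lem M in
       valid A1' × valid A2'' × valid T2 × ¬ valid (◇ ∃ᴱ𝒢))
    × ((M : Model) → Reflexive (Model.r M) → let open Sem lem M in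
       valid A1' → valid A2'' → valid T2 → valid (◇ ∃ᴱ𝒢))
mainTheorem4 lem =
    (λ M a1 a2 t2 → let exists = godlike-exists lem M a1 a2 t2
                    in  exists , necessitation lem M _ exists)
  , (BlindPoint , BlindPoint-A1' lem , BlindPoint-A2'' lem , BlindPoint-T2 lem
                , BlindPoint-not-◇∃ᴱ𝒢 lem)
  , (λ M reflexive a1 a2 t2 →
       valid⇒possible lem M reflexive _ (godlike-exists lem M a1 a2 t2))
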